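{- If $I = (1,1,1)$ then $L(n,I) \geq F^*_n$ for every $n \in \mathbb{N}$.
   Context: For $n \in \mathbb{N}$ and $I=(I_1,I_2,I_3) \in \{0,1\}^3$, $M_I^{(n)}$ is the tournament on $\{x_1,\ldots,x_{2n}\} \cup \{y_1,\ldots,y_n\}$ with: (i) $x_i \to x_j$ for $i<j$; (ii) $x_{2i} \to y_i \to x_{2i-1}$ for each $i \in [n]$; (iii) for $i<j$, $y_i \to y_j$ iff $I_1=1$; (iv) for $i \le 2j-2$, $x_i \to y_j$ iff $I_2 = 1$; (v) for $i \ge 2j+1$, $y_j \to x_i$ iff $I_3 = 1$. $L(n,I)$ is the number of pairwise non-isomorphic $n$-vertex tournaments that are isomorphic to an induced sub-tournament of $M_I^{(m)}$ for some (equivalently all sufficiently large) $m$. $F^*_0=F^*_1=F^*_2=1$ and $F^*_n = F^*_{n-1}+F^*_{n-3}$ for $n \ge 3$. -}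

module Defs where

open import Data.Bool using (Bool; true; false; not; if_then_else_)
open import Data.Bool.Properties using (not-involutive)
open import Data.Nat using (ℕ; zero; suc; _+_; _*_; _<ᵇ_; _≡ᵇ_)
open import Data.Fin using (Fin; toℕ)
open import Data.Fin.Properties using (toℕ-injective)
open import Data.Sum using (_⊎_; inj₁; inj₂)
open import Data.Product using (Σ; _×_; _,_)
open import Function.Bundles using (_↔_; Inverse)
open import Function.Definitions using (Injective)
open import Relation.Binary.PropositionalEquality using (_≡_; _≢_; refl; cong; sym)
open import Relation.Nullary using (¬_)

record Tournament (V : Set) : Set where
  field
    beats  : V → V → Bool
    irrefl : ∀ u → beats u u ≡ false
    tot    : ∀ u v → u ≢ v → beats u v ≡ not (beats v u)
open Tournament public

_≅_ : {V W : Set} → Tournament V → Tournament W → Set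
_≅_ {V} {W} S T =
  Σ (V ↔ W) λ f → ∀ u v → beats T (Inverse.to f u) (Inverse.to f v) ≡ beats S u v

Embeds : {V W : Set} → Tournament V → Tournament W → Set
Embeds {V} {W} S T =
  Σ (V → W) λ f → Injective _≡_ _≡_ f × (∀ u v → beats T (f u) (f v) ≡ beats S u v)

-- The tournament M_I^(m).  Vertices: inj₁ a = x_{a+1} (a < 2m),
-- inj₂ b = y_{b+1} (b < m)   (0-indexed versions of the paper's indices).

MVert : ℕ → Set
MVert m = Fin (2 * m) ⊎ Fin m

-- arc between x_{a+1} and y_{b+1}: true iff x_{a+1} → y_{b+1}
-- paper (1-indexed i = a+1, j = b+1):
--   i ≤ 2j-2  (a < 2b)     : x_i → y_j iff I₂
--   i = 2j-1  (a = 2b)     : y_j → x_i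
--   i = 2j    (a = 2b+1)   : x_i → y_j
--   i ≥ 2j+1  (a ≥ 2b+2)   : y_j → x_i iff I₃
xy : Bool → Bool → ℕ → ℕ → Bool
xy I₂ I₃ a b =
  if a <ᵇ (2 * b) then I₂
  else if a ≡ᵇ (2 * b) then false
  else if a ≡ᵇ suc (2 * b) then true
  else not I₃

yy : Bool → ℕ → ℕ → Bool
yy I₁ b c = if b <ᵇ c then I₁ else (if c <ᵇ b then not I₁ else false)

Mbeats : Bool × Bool × Bool → (m : ℕ) → MVert m → MVert m → Bool
Mbeats _ m (inj₁ a) (inj₁ a') = toℕ a <ᵇ toℕ a'
Mbeats (_ , I₂ , I₃) m (inj₁ a) (inj₂ b) = xy I₂ I₃ (toℕ a) (toℕ b)
Mbeats (_ , I₂ , I₃) m (inj₂ b) (inj₁ a) = not (xy I₂ I₃ (toℕ a) (toℕ b))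
Mbeats (I₁ , _ , _) m (inj₂ b) (inj₂ c) = yy I₁ (toℕ b) (toℕ c)

private
  <ᵇ-irrefl : ∀ n → (n <ᵇ n) ≡ false
  <ᵇ-irrefl zero = refl
  <ᵇ-irrefl (suc n) = <ᵇ-irrefl n

  <ᵇ-tot : ∀ m n → m ≢ n → (m <ᵇ n) ≡ not (n <ᵇ m)
  <ᵇ-tot zero zero ne with ne refl
  ... | ()
  <ᵇ-tot zero (suc n) ne = refl
  <ᵇ-tot (suc m) zero ne = refl
  <ᵇ-tot (suc m) (suc n) ne = <ᵇ-tot m n (λ e → ne (cong suc e))

  yy-irrefl : ∀ I₁ b → yy I₁ b b ≡ false
  yy-irrefl I₁ b with b <ᵇ b | <ᵇ-irrefl b
  ... | false | _ = refl

  yy-tot : ∀ I₁ b c → b ≢ c → yy I₁ b c ≡ not (yy I₁ c b)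
  yy-tot I₁ b c ne with b <ᵇ c | c <ᵇ b | <ᵇ-tot b c ne
  ... | true  | false | _ = sym (not-involutive I₁)
  ... | false | true  | _ = refl

Mirrefl : ∀ I m u → Mbeats I m u u ≡ false
Mirrefl I m (inj₁ a) = <ᵇ-irrefl (toℕ a)
Mirrefl (I₁ , _ , _) m (inj₂ b) = yy-irrefl I₁ (toℕ b)

Mtot : ∀ I m u v → u ≢ v → Mbeats I m u v ≡ not (Mbeats I m v u)
Mtot I m (inj₁ a) (inj₁ a') ne =
  <ᵇ-tot (toℕ a) (toℕ a') (λ e → ne (cong inj₁ (toℕ-injective e)))
Mtot (_ , I₂ , I₃) m (inj₁ a) (inj₂ b) ne = sym (not-involutive _)
Mtot (_ , I₂ , I₃) m (inj₂ b) (inj₁ a) ne = refl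
Mtot (I₁ , _ , _) m (inj₂ b) (inj₂ c) ne =
  yy-tot I₁ (toℕ b) (toℕ c) (λ e → ne (cong inj₂ (toℕ-injective e)))

M : Bool × Bool × Bool → (m : ℕ) → Tournament (MVert m)
M I m = record { beats = Mbeats I m ; irrefl = Mirrefl I m ; tot = Mtot I m }

Fstar : ℕ → ℕ
Fstar zero = 1
Fstar (suc zero) = 1
Fstar (suc (suc zero)) = 1
Fstar (suc (suc (suc n))) = Fstar (suc (suc n)) + Fstar n

-- Compositions of n into parts 1 and 3 are counted by F*_n.  Read the parts of
-- such a composition as blocks (a single vertex, or a cyclic triangle) and let
-- every block beat all later blocks.  In M_(1,1,1) a single vertex can be put
-- at y₁ and a cyclic triangle at y₁, x₁, x₂; both beat every vertex of the copy
-- of M shifted by one y and two x's, where the remaining blocks go.  The score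
-- multiset tells the tournaments apart: the first block of a tournament with r
-- vertices after it scores r (single vertex) or r + 1 (triangle), no later
-- vertex scores more than r, and removing the first block leaves the other
-- scores unchanged.
module Submission where

open import Defs
open import Data.Bool using (Bool; true; false; not)
open import Data.Nat using (ℕ; zero; suc; _+_; _*_; _≤_; _<_; _<ᵇ_; _≡ᵇ_; z≤n; s≤s)
open import Data.Nat.Properties
  using (+-assoc; +-suc; +-cancelˡ-≡; ≤-<-trans; <-≤-trans; *-monoʳ-≤; m≤n⇒m≤1+n; m≤n+m; n<1+n)
open import Data.Fin using (Fin; zero; suc; toℕ; fromℕ<; splitAt; join; _↑ˡ_; _↑ʳ_)
open import Data.Fin.Properties using (toℕ-fromℕ<; +↔⊎; splitAt-join) renaming (_≟_ to _≟ᶠ_)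
open import Data.Sum using (_⊎_; inj₁; inj₂; [_,_])
open import Data.Product using (Σ; ∃; _×_; _,_; proj₁)
open import Function using (_∘_)
open import Function.Bundles using (Inverse; Injection)
open import Function.Definitions using (Injective)
open import Function.Properties.Inverse using (↔⇒↣)
open import Relation.Binary.Definitions using (DecidableEquality)
open import Relation.Binary.PropositionalEquality
  using (_≡_; _≢_; refl; cong; cong₂; sym; trans; module ≡-Reasoning)
open import Relation.Nullary using (yes; no; contradiction)
open import Algebra.Properties.CommutativeMonoid.Sum Data.Nat.Properties.+-0-commutativeMonoid
  using (sum; sum-cong-≗; ∑-permute)

private variable
  V W : Set
  k m n s : ℕ

-- Constructions of tournaments

_⊕_ : Tournament V → Tournament W → Tournament (V ⊎ W)
_⊕_ {V} {W} S T = record { beats = beats⊕ ; irrefl = irrefl⊕ ; tot = tot⊕ }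
  where
  beats⊕ : V ⊎ W → V ⊎ W → Bool
  beats⊕ (inj₁ a) (inj₁ b) = beats S a b
  beats⊕ (inj₁ _) (inj₂ _) = true
  beats⊕ (inj₂ _) (inj₁ _) = false
  beats⊕ (inj₂ a) (inj₂ b) = beats T a b

  irrefl⊕ : ∀ u → beats⊕ u u ≡ false
  irrefl⊕ (inj₁ a) = irrefl S a
  irrefl⊕ (inj₂ b) = irrefl T b

  tot⊕ : ∀ u v → u ≢ v → beats⊕ u v ≡ not (beats⊕ v u)
  tot⊕ (inj₁ a) (inj₁ b) u≢v = tot S a b (u≢v ∘ cong inj₁)
  tot⊕ (inj₁ _) (inj₂ _) _   = refl
  tot⊕ (inj₂ _) (inj₁ _) _   = refl
  tot⊕ (inj₂ a) (inj₂ b) u≢v = tot T a b (u≢v ∘ cong inj₂)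

induced : (f : V → W) → Injective _≡_ _≡_ f → Tournament W → Tournament V
induced f f-injective T = record
  { beats  = λ u v → beats T (f u) (f v)
  ; irrefl = λ u → irrefl T (f u)
  ; tot    = λ u v u≢v → tot T (f u) (f v) (u≢v ∘ f-injective)
  }

_▷_ : Tournament (Fin k) → Tournament (Fin n) → Tournament (Fin (k + n))
_▷_ {k} B T = induced (splitAt k) (Injection.injective (↔⇒↣ +↔⊎)) (B ⊕ T)

▷-beats-join : (B : Tournament (Fin k)) (T : Tournament (Fin n)) (s t : Fin k ⊎ Fin n) →
               beats (B ▷ T) (join k n s) (join k n t) ≡ beats (B ⊕ T) s t
▷-beats-join {k} {n} B T s t = cong₂ (beats (B ⊕ T)) (splitAt-join k n s) (splitAt-join k n t)

empty : Tournament (Fin 0)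
empty = record { beats = λ () ; irrefl = λ () ; tot = λ () }

● : Tournament (Fin 1)
● = record
  { beats  = λ _ _ → false
  ; irrefl = λ _ → refl
  ; tot    = λ { zero zero ne → contradiction refl ne }
  }

△ : Tournament (Fin 3)
△ = record { beats = cyclic ; irrefl = irrefl△ ; tot = tot△ }
  where
  cyclic : Fin 3 → Fin 3 → Bool
  cyclic zero             (suc zero)       = true
  cyclic (suc zero)       (suc (suc zero)) = true
  cyclic (suc (suc zero)) zero             = true
  cyclic _                _                = false

  irrefl△ : ∀ u → cyclic u u ≡ false
  irrefl△ zero             = refl
  irrefl△ (suc zero)       = refl
  irrefl△ (suc (suc zero)) = refl

  tot△ : ∀ u v → u ≢ v → cyclic u v ≡ not (cyclic v u)
  tot△ zero             zero             ne = contradiction refl ne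
  tot△ zero             (suc zero)       _  = refl
  tot△ zero             (suc (suc zero)) _  = refl
  tot△ (suc zero)       zero             _  = refl
  tot△ (suc zero)       (suc zero)       ne = contradiction refl ne
  tot△ (suc zero)       (suc (suc zero)) _  = refl
  tot△ (suc (suc zero)) zero             _  = refl
  tot△ (suc (suc zero)) (suc zero)       _  = refl
  tot△ (suc (suc zero)) (suc (suc zero)) ne = contradiction refl ne

preserving⇒injective : DecidableEquality V → (S : Tournament V) (T : Tournament W) (f : V → W) →
                       (∀ u v → beats T (f u) (f v) ≡ beats S u v) → Injective _≡_ _≡_ f
preserving⇒injective _≟_ S T f pres {u} {v} fu≡fv with u ≟ v
... | yes u≡v = u≡v
... | no u≢v  =
  contradiction (trans (sym (no-arc fu≡fv)) (trans (tot S u v u≢v) (cong not (no-arc (sym fu≡fv))))) λ ()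
  where
  no-arc : ∀ {x y} → f x ≡ f y → beats S x y ≡ false
  no-arc {x} {y} fx≡fy = trans (sym (pres x y)) (trans (cong (beats T (f x)) (sym fx≡fy)) (irrefl T (f x)))

-- Scores

indicator : Bool → ℕ
indicator true  = 1
indicator false = 0

score : Tournament (Fin n) → Fin n → ℕ
score T u = sum (indicator ∘ beats T u)

scoreCount : Tournament (Fin n) → ℕ → ℕ
scoreCount T s = sum (λ u → indicator (score T u ≡ᵇ s))

score-≅ : {S T : Tournament (Fin n)} (S≅T : S ≅ T) →
          ∀ u → score T (Inverse.to (proj₁ S≅T) u) ≡ score S u
score-≅ {T = T} (f , pres) u =
  trans (∑-permute (indicator ∘ beats T (Inverse.to f u)) f) (sum-cong-≗ (cong indicator ∘ pres u))

scoreCount-≅ : {S T : Tournament (Fin n)} → S ≅ T → ∀ s → scoreCount S s ≡ scoreCount T s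
scoreCount-≅ {S = S} {T = T} S≅T@(f , _) s =
  trans (sum-cong-≗ (λ u → cong (λ x → indicator (x ≡ᵇ s)) (sym (score-≅ {S = S} {T = T} S≅T u))))
        (sym (∑-permute (λ u → indicator (score T u ≡ᵇ s)) f))

sum-↑ : ∀ k n (f : Fin (k + n) → ℕ) → sum f ≡ sum (f ∘ (_↑ˡ n)) + sum (f ∘ (k ↑ʳ_))
sum-↑ zero    n f = refl
sum-↑ (suc k) n f = trans (cong (f zero +_) (sum-↑ k n (f ∘ suc))) (sym (+-assoc (f zero) _ _))

sum-zeros : ∀ n → sum {n} (λ _ → 0) ≡ 0
sum-zeros zero    = refl
sum-zeros (suc n) = sum-zeros n

sum-ones : ∀ n → sum {n} (λ _ → 1) ≡ n
sum-ones zero    = refl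
sum-ones (suc n) = cong suc (sum-ones n)

sum-indicator≤ : (p : Fin n → Bool) → sum (indicator ∘ p) ≤ n
sum-indicator≤ {zero}  p = z≤n
sum-indicator≤ {suc n} p with p zero
... | true  = s≤s (sum-indicator≤ (p ∘ suc))
... | false = m≤n⇒m≤1+n (sum-indicator≤ (p ∘ suc))

≡ᵇ-refl : ∀ n → (n ≡ᵇ n) ≡ true
≡ᵇ-refl zero    = refl
≡ᵇ-refl (suc n) = ≡ᵇ-refl n

<⇒≡ᵇ-false : m < n → (m ≡ᵇ n) ≡ false
<⇒≡ᵇ-false {zero}  {suc n} _         = refl
<⇒≡ᵇ-false {suc m} {suc n} (s≤s m<n) = <⇒≡ᵇ-false m<n

scoreCount-vanishes : (T : Tournament (Fin n)) → n < s → scoreCount T s ≡ 0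
scoreCount-vanishes {n} T n<s =
  trans (sum-cong-≗ (λ u → cong indicator (<⇒≡ᵇ-false (≤-<-trans (sum-indicator≤ (beats T u)) n<s))))
        (sum-zeros n)

score-▷ˡ : (B : Tournament (Fin k)) (T : Tournament (Fin n)) (a : Fin k) →
           score (B ▷ T) (a ↑ˡ n) ≡ score B a + n
score-▷ˡ {k} {n} B T a = begin
  score (B ▷ T) (a ↑ˡ n)
    ≡⟨ sum-↑ k n _ ⟩
  sum (λ b → indicator (beats (B ▷ T) (a ↑ˡ n) (b ↑ˡ n)))
    + sum (λ v → indicator (beats (B ▷ T) (a ↑ˡ n) (k ↑ʳ v)))
    ≡⟨ cong₂ _+_ (sum-cong-≗ (λ b → cong indicator (▷-beats-join B T (inj₁ a) (inj₁ b))))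
                 (sum-cong-≗ (λ v → cong indicator (▷-beats-join B T (inj₁ a) (inj₂ v)))) ⟩
  score B a + sum {n} (λ _ → 1)
    ≡⟨ cong (score B a +_) (sum-ones n) ⟩
  score B a + n ∎
  where open ≡-Reasoning

score-▷ʳ : (B : Tournament (Fin k)) (T : Tournament (Fin n)) (v : Fin n) →
           score (B ▷ T) (k ↑ʳ v) ≡ score T v
score-▷ʳ {k} {n} B T v = begin
  score (B ▷ T) (k ↑ʳ v)
    ≡⟨ sum-↑ k n _ ⟩
  sum (λ b → indicator (beats (B ▷ T) (k ↑ʳ v) (b ↑ˡ n)))
    + sum (λ w → indicator (beats (B ▷ T) (k ↑ʳ v) (k ↑ʳ w)))
    ≡⟨ cong₂ _+_ (sum-cong-≗ (λ b → cong indicator (▷-beats-join B T (inj₂ v) (inj₁ b))))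
                 (sum-cong-≗ (λ w → cong indicator (▷-beats-join B T (inj₂ v) (inj₂ w)))) ⟩
  sum {k} (λ _ → 0) + score T v
    ≡⟨ cong (_+ score T v) (sum-zeros k) ⟩
  0 + score T v ∎
  where open ≡-Reasoning

scoreCount-▷ : (B : Tournament (Fin k)) (T : Tournament (Fin n)) (s : ℕ) →
               scoreCount (B ▷ T) s ≡ sum (λ a → indicator (score B a + n ≡ᵇ s)) + scoreCount T s
scoreCount-▷ {k} {n} B T s = trans (sum-↑ k n _) (cong₂ _+_
  (sum-cong-≗ (λ a → cong (λ x → indicator (x ≡ᵇ s)) (score-▷ˡ B T a)))
  (sum-cong-≗ (λ v → cong (λ x → indicator (x ≡ᵇ s)) (score-▷ʳ B T v))))

scoreCount-▷-cancelˡ : (B : Tournament (Fin k)) (T T′ : Tournament (Fin n)) →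
                       (∀ s → scoreCount (B ▷ T) s ≡ scoreCount (B ▷ T′) s) →
                       ∀ s → scoreCount T s ≡ scoreCount T′ s
scoreCount-▷-cancelˡ B T T′ eq s =
  +-cancelˡ-≡ _ _ _ (trans (sym (scoreCount-▷ B T s)) (trans (eq s) (scoreCount-▷ B T′ s)))

-- Chains of single vertices and cyclic triangles

data Chain : ℕ → Set where
  []   : Chain 0
  ●∷_ : Chain n → Chain (1 + n)
  △∷_ : Chain n → Chain (3 + n)

chain : Chain n → Tournament (Fin n)
chain []     = empty
chain (●∷ c) = ● ▷ chain c
chain (△∷ c) = △ ▷ chain c

●∷-top : (c : Chain n) → scoreCount (chain (●∷ c)) n ≢ 0
●∷-top {n} c rewrite scoreCount-▷ ● (chain c) n | ≡ᵇ-refl n = λ ()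

△∷-top : (c : Chain n) → scoreCount (chain (△∷ c)) (2 + n) ≡ 0
△∷-top {n} c
  rewrite scoreCount-▷ △ (chain c) (2 + n) | <⇒≡ᵇ-false (n<1+n n)
  = scoreCount-vanishes (chain c) (m≤n⇒m≤1+n (n<1+n n))

chain-determined-by-scoreCount : (c d : Chain n) →
  (∀ s → scoreCount (chain c) s ≡ scoreCount (chain d) s) → c ≡ d
chain-determined-by-scoreCount []     []     _  = refl
chain-determined-by-scoreCount (●∷ c) (●∷ d) eq =
  cong ●∷_ (chain-determined-by-scoreCount c d (scoreCount-▷-cancelˡ ● (chain c) (chain d) eq))
chain-determined-by-scoreCount (△∷ c) (△∷ d) eq =
  cong △∷_ (chain-determined-by-scoreCount c d (scoreCount-▷-cancelˡ △ (chain c) (chain d) eq))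
chain-determined-by-scoreCount {suc (suc (suc n))} (●∷ c) (△∷ d) eq =
  contradiction (trans (eq (2 + n)) (△∷-top d)) (●∷-top c)
chain-determined-by-scoreCount {suc (suc (suc n))} (△∷ c) (●∷ d) eq =
  contradiction (trans (sym (eq (2 + n))) (△∷-top c)) (●∷-top d)

chains : ∀ n → Fin (Fstar n) → Chain n
chains zero                _ = []
chains (suc zero)          _ = ●∷ []
chains (suc (suc zero))    _ = ●∷ ●∷ []
chains (suc (suc (suc n))) i =
  [ ●∷_ ∘ chains (suc (suc n)) , △∷_ ∘ chains n ] (splitAt (Fstar (suc (suc n))) i)

[●∷,△∷]-injective : {A B : Set} {f : A → Chain (2 + n)} {g : B → Chain n} →
  Injective _≡_ _≡_ f → Injective _≡_ _≡_ g → Injective _≡_ _≡_ [ ●∷_ ∘ f , △∷_ ∘ g ]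
[●∷,△∷]-injective f-injective g-injective {inj₁ _} {inj₁ _} eq = cong inj₁ (f-injective (●∷-injective eq))
  where
  ●∷-injective : {c d : Chain (2 + _)} → ●∷ c ≡ ●∷ d → c ≡ d
  ●∷-injective refl = refl
[●∷,△∷]-injective f-injective g-injective {inj₂ _} {inj₂ _} eq = cong inj₂ (g-injective (△∷-injective eq))
  where
  △∷-injective : {c d : Chain _} → △∷ c ≡ △∷ d → c ≡ d
  △∷-injective refl = refl

chains-injective : ∀ n → Injective _≡_ _≡_ (chains n)
chains-injective zero                {zero} {zero} _ = refl
chains-injective (suc zero)          {zero} {zero} _ = refl
chains-injective (suc (suc zero))    {zero} {zero} _ = refl
chains-injective (suc (suc (suc n))) eq =
  Injection.injective (↔⇒↣ +↔⊎)
    ([●∷,△∷]-injective (chains-injective (suc (suc n))) (chains-injective n) eq)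

-- Placing chains in M

-- inj₁ a stands for x_{a+1} and inj₂ b for y_{b+1} of M_I^(m), for any m
-- large enough; Mbeats only ever looks at the indices.
Point : Set
Point = ℕ ⊎ ℕ

M∞ : Bool × Bool × Bool → Point → Point → Bool
M∞ _              (inj₁ a) (inj₁ a′) = a <ᵇ a′
M∞ (_ , I₂ , I₃) (inj₁ a) (inj₂ b)  = xy I₂ I₃ a b
M∞ (_ , I₂ , I₃) (inj₂ b) (inj₁ a)  = not (xy I₂ I₃ a b)
M∞ (I₁ , _ , _)  (inj₂ b) (inj₂ c)  = yy I₁ b c

toPoint : MVert m → Point
toPoint (inj₁ a) = inj₁ (toℕ a)
toPoint (inj₂ b) = inj₂ (toℕ b)

Mbeats≡M∞ : ∀ I (u v : MVert m) → Mbeats I m u v ≡ M∞ I (toPoint u) (toPoint v)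
Mbeats≡M∞ I (inj₁ _) (inj₁ _) = refl
Mbeats≡M∞ I (inj₁ _) (inj₂ _) = refl
Mbeats≡M∞ I (inj₂ _) (inj₁ _) = refl
Mbeats≡M∞ I (inj₂ _) (inj₂ _) = refl

InM : ℕ → Point → Set
InM m (inj₁ a) = a < 2 * m
InM m (inj₂ b) = b < m

restrict : (x : Point) → InM m x → MVert m
restrict (inj₁ a) a<2m = inj₁ (fromℕ< a<2m)
restrict (inj₂ b) b<m  = inj₂ (fromℕ< b<m)

toPoint-restrict : (x : Point) (x∈M : InM m x) → toPoint (restrict x x∈M) ≡ x
toPoint-restrict (inj₁ _) a<2m = cong inj₁ (toℕ-fromℕ< a<2m)
toPoint-restrict (inj₂ _) b<m  = cong inj₂ (toℕ-fromℕ< b<m)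

InM-mono : m ≤ n → ∀ x → InM m x → InM n x
InM-mono m≤n (inj₁ _) a<2m = <-≤-trans a<2m (*-monoʳ-≤ 2 m≤n)
InM-mono m≤n (inj₂ _) b<m  = <-≤-trans b<m m≤n

embeds-via : ∀ I (T : Tournament (Fin n)) (p : Fin n → Point) → (∀ u → InM m (p u)) →
             (∀ u v → M∞ I (p u) (p v) ≡ beats T u v) → Embeds T (M I m)
embeds-via {m = m} I T p p∈M p-pres = f , preserving⇒injective _≟ᶠ_ T (M I m) f f-pres , f-pres
  where
  f : _ → MVert m
  f u = restrict (p u) (p∈M u)

  f-pres : ∀ u v → Mbeats I m (f u) (f v) ≡ beats T u v
  f-pres u v = trans (Mbeats≡M∞ I (f u) (f v))
    (trans (cong₂ (M∞ I) (toPoint-restrict (p u) (p∈M u)) (toPoint-restrict (p v) (p∈M v)))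
           (p-pres u v))

shift : Point → Point
shift (inj₁ a) = inj₁ (2 + a)
shift (inj₂ b) = inj₂ (1 + b)

-- 2 * suc b only normalises to suc (b + suc (b + 0)), hence the rewrites by +-suc.
M∞-shift : ∀ I u v → M∞ I (shift u) (shift v) ≡ M∞ I u v
M∞-shift I (inj₁ a) (inj₁ a′) = refl
M∞-shift (_ , I₂ , I₃) (inj₁ a) (inj₂ b) rewrite +-suc b (b + 0) = refl
M∞-shift (_ , I₂ , I₃) (inj₂ b) (inj₁ a) rewrite +-suc b (b + 0) = refl
M∞-shift I (inj₂ b) (inj₂ c) = refl

shift-InM : ∀ x → InM m x → InM (suc m) (shift x)
shift-InM {m} (inj₁ _) a<2m rewrite +-suc m (m + 0) = s≤s (s≤s a<2m)
shift-InM     (inj₂ _) b<m  = s≤s b<m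

⊕-placed : ∀ I {B : Tournament V} {T : Tournament W} (p : V → Point) (q : W → Point) →
  (∀ a b → M∞ I (p a) (p b) ≡ beats B a b) → (∀ u v → M∞ I (q u) (q v) ≡ beats T u v) →
  (∀ a x → M∞ I (p a) (shift x) ≡ true) → (∀ a x → M∞ I (shift x) (p a) ≡ false) →
  ∀ s t → M∞ I ([ p , shift ∘ q ] s) ([ p , shift ∘ q ] t) ≡ beats (B ⊕ T) s t
⊕-placed I p q p-pres q-pres above below (inj₁ a) (inj₁ b) = p-pres a b
⊕-placed I p q p-pres q-pres above below (inj₁ a) (inj₂ v) = above a (q v)
⊕-placed I p q p-pres q-pres above below (inj₂ u) (inj₁ b) = below b (q u)
⊕-placed I p q p-pres q-pres above below (inj₂ u) (inj₂ v) = trans (M∞-shift I (q u) (q v)) (q-pres u v)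

I₁₁₁ : Bool × Bool × Bool
I₁₁₁ = true , true , true

place● : Fin 1 → Point
place● zero = inj₂ 0

●-placed : ∀ a b → M∞ I₁₁₁ (place● a) (place● b) ≡ beats ● a b
●-placed zero zero = refl

●-above : ∀ a x → M∞ I₁₁₁ (place● a) (shift x) ≡ true
●-above zero (inj₁ _) = refl
●-above zero (inj₂ _) = refl

●-below : ∀ a x → M∞ I₁₁₁ (shift x) (place● a) ≡ false
●-below zero (inj₁ _) = refl
●-below zero (inj₂ _) = refl

place△ : Fin 3 → Point
place△ zero             = inj₂ 0
place△ (suc zero)       = inj₁ 0
place△ (suc (suc zero)) = inj₁ 1

△-placed : ∀ a b → M∞ I₁₁₁ (place△ a) (place△ b) ≡ beats △ a b
△-placed zero             zero             = refl
△-placed zero             (suc zero)       = refl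
△-placed zero             (suc (suc zero)) = refl
△-placed (suc zero)       zero             = refl
△-placed (suc zero)       (suc zero)       = refl
△-placed (suc zero)       (suc (suc zero)) = refl
△-placed (suc (suc zero)) zero             = refl
△-placed (suc (suc zero)) (suc zero)       = refl
△-placed (suc (suc zero)) (suc (suc zero)) = refl

△-above : ∀ a x → M∞ I₁₁₁ (place△ a) (shift x) ≡ true
△-above zero             (inj₁ _) = refl
△-above zero             (inj₂ _) = refl
△-above (suc zero)       (inj₁ _) = refl
△-above (suc zero)       (inj₂ _) = refl
△-above (suc (suc zero)) (inj₁ _) = refl
△-above (suc (suc zero)) (inj₂ b) rewrite +-suc b (b + 0) = refl

△-below : ∀ a x → M∞ I₁₁₁ (shift x) (place△ a) ≡ false
△-below zero             (inj₁ _) = refl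
△-below zero             (inj₂ _) = refl
△-below (suc zero)       (inj₁ _) = refl
△-below (suc zero)       (inj₂ _) = refl
△-below (suc (suc zero)) (inj₁ _) = refl
△-below (suc (suc zero)) (inj₂ b) rewrite +-suc b (b + 0) = refl

place : Chain n → Fin n → Point
place []     = λ ()
place (●∷ c) = [ place● , shift ∘ place c ] ∘ splitAt 1
place (△∷ c) = [ place△ , shift ∘ place c ] ∘ splitAt 3

place-InM : (c : Chain n) → ∀ u → InM n (place c u)
place-InM [] ()
place-InM (●∷ c) zero                = s≤s z≤n
place-InM (●∷ c) (suc u)             = shift-InM (place c u) (place-InM c u)
place-InM (△∷ c) zero                = s≤s z≤n
place-InM (△∷ c) (suc zero)          = s≤s z≤n
place-InM (△∷ c) (suc (suc zero))    = s≤s (s≤s z≤n)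
place-InM (△∷ c) (suc (suc (suc u))) =
  InM-mono (m≤n+m _ 2) (shift (place c u)) (shift-InM (place c u) (place-InM c u))

place-preserves : (c : Chain n) → ∀ u v → M∞ I₁₁₁ (place c u) (place c v) ≡ beats (chain c) u v
place-preserves [] ()
place-preserves (●∷ c) u v =
  ⊕-placed I₁₁₁ place● (place c) ●-placed (place-preserves c) ●-above ●-below
    (splitAt 1 u) (splitAt 1 v)
place-preserves (△∷ c) u v =
  ⊕-placed I₁₁₁ place△ (place c) △-placed (place-preserves c) △-above △-below
    (splitAt 3 u) (splitAt 3 v)

chain-embeds : (c : Chain n) → Embeds (chain c) (M I₁₁₁ n)
chain-embeds c = embeds-via I₁₁₁ (chain c) (place c) (place-InM c) (place-preserves c)

lemma12 : (n : ℕ) →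
    Σ (Fin (Fstar n) → Tournament (Fin n)) λ T →
      (∀ k → ∃ λ m → Embeds (T k) (M (true , true , true) m)) ×
      (∀ k l → T k ≅ T l → k ≡ l)
lemma12 n =
  chain ∘ chains n ,
  (λ i → n , chain-embeds (chains n i)) ,
  λ i j Tᵢ≅Tⱼ → chains-injective n
    (chain-determined-by-scoreCount (chains n i) (chains n j)
      (scoreCount-≅ {S = chain (chains n i)} {T = chain (chains n j)} Tᵢ≅Tⱼ))
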